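{- Consider an altered Wythoff game and a natural column $t$. Then $\mathrm{row}_t[y]$ is TRUE for all integers $0\le y<\ell_t$, and $\mathrm{row}_t[y]$ is FALSE for all integers $y>u_t$.
   Context: Wythoff's game: a position is a pair $(x,y)$ of non-negative integers ($x$ = column, $y$ = row). A move from $(x,y)$ goes to $(x-k,y)$, $(x,y-k)$ or $(x-k,y-k)$ for some integer $k\ge1$, with non-negative result. An altered Wythoff game is given by finite disjoint sets $\mathcal{P},\mathcal{N}\subset\mathbb{Z}_{\ge0}^2$; positions are labelled by recursion on $x+y$: positions in $\mathcal{P}$ are P, positions in $\mathcal{N}$ are N, any other position is P if no position reachable in one move is labelled P, and N otherwise. Fix $m_x$ such that every element of $\mathcal{P}\cup\mathcal{N}$ has first coordinate $<m_x$; a column $t$ is natural if $t\ge m_x$ (each natural column contains exactly one P-position). For a column $t$ and integer $y\ge 0$: $\mathrm{row}_t[y]$ is TRUE iff there is a P-position $(x',y)$ with $x'\le t$; $\mathrm{diag}_t[y]$ is TRUE iff the diagonal $\{(t-k,y-k):k\ge0\}$ contains a P-position. $\ell_t$ is the minimum and $u_t$ the maximum $y$ with $\mathrm{diag}_t[y]$ TRUE. -}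

module Defs where

open import Data.Nat using (ℕ; zero; suc; _+_; _∸_; _≤_; _<_; _⊓_)
open import Data.Nat.Properties using (_≟_)
open import Data.Bool using (Bool; true; false; not; if_then_else_; _∧_; _∨_)
open import Data.List using (List; map; upTo)
open import Data.Bool.ListAction using (any)
open import Data.List.Membership.Propositional using (_∈_)
open import Data.Product using (_×_; _,_; Σ-syntax)
open import Relation.Nullary using (¬_)
open import Relation.Nullary.Decidable using (⌊_⌋)
open import Relation.Binary.PropositionalEquality using (_≡_)

-- A position (x , y): x = column, y = row.
Pos : Set
Pos = ℕ × ℕ

memB : Pos → List Pos → Bool
memB (x , y) = any (λ { (a , b) → ⌊ x ≟ a ⌋ ∧ ⌊ y ≟ b ⌋ })

anyUpTo : ℕ → (ℕ → Bool) → Bool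
anyUpTo n f = any f (map suc (upTo n))

-- Labelling with fuel; true = P, false = N.  Every move decreases x + y by
-- at least 1, so fuel  suc (x + y)  suffices to compute the label of (x , y).
labelF : List Pos → List Pos → ℕ → ℕ → ℕ → Bool
labelF Ps Ns zero x y = false
labelF Ps Ns (suc f) x y =
  if memB (x , y) Ps then true
  else if memB (x , y) Ns then false
  else not ( anyUpTo x (λ k → labelF Ps Ns f (x ∸ k) y)
           ∨ anyUpTo y (λ k → labelF Ps Ns f x (y ∸ k))
           ∨ anyUpTo (x ⊓ y) (λ k → labelF Ps Ns f (x ∸ k) (y ∸ k)))

-- The altered Wythoff game given by the finite sets 𝒫 = Ps, 𝒩 = Ns:
-- isP Ps Ns x y ≡ true  iff  (x , y) is a P-position.
isP : List Pos → List Pos → ℕ → ℕ → Bool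
isP Ps Ns x y = labelF Ps Ns (suc (x + y)) x y

Disjoint : List Pos → List Pos → Set
Disjoint Ps Ns = ∀ p → p ∈ Ps → ¬ (p ∈ Ns)

BoundsFirst : ℕ → List Pos → List Pos → Set
BoundsFirst mx Ps Ns =
  (∀ x y → (x , y) ∈ Ps → x < mx) × (∀ x y → (x , y) ∈ Ns → x < mx)

Row : List Pos → List Pos → ℕ → ℕ → Set
Row Ps Ns t y = Σ[ x' ∈ ℕ ] (x' ≤ t × isP Ps Ns x' y ≡ true)

Diag : List Pos → List Pos → ℕ → ℕ → Set
Diag Ps Ns t y = Σ[ k ∈ ℕ ] (k ≤ t × k ≤ y × isP Ps Ns (t ∸ k) (y ∸ k) ≡ true)

IsMinDiag : List Pos → List Pos → ℕ → ℕ → Set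
IsMinDiag Ps Ns t l = Diag Ps Ns t l × (∀ y → Diag Ps Ns t y → l ≤ y)

IsMaxDiag : List Pos → List Pos → ℕ → ℕ → Set
IsMaxDiag Ps Ns t u = Diag Ps Ns t u × (∀ y → Diag Ps Ns t y → y ≤ u)

-- In a natural column t the position (t , y) is not altered, so it follows the Wythoff rule.
-- For y < ℓ_t it cannot have a P-follower below it or on its diagonal, since that follower
-- would witness diag_t at a height ≤ y; hence (t , y) is a P-position or has one to its left,
-- and either way row_t[y] holds. Conversely a P-position (x′ , y) with x′ ≤ t lies on the
-- diagonal of column t at height y + (t − x′) ≥ y, so row_t[y] forces y ≤ u_t.
module Submission where

open import Defs
open import Data.Nat using (ℕ; suc; _+_; _∸_; _⊓_; _≤_; _<_; s≤s; z≤n)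
open import Data.Nat.Properties
  using (_≟_; ≤-refl; ≤-trans; <-≤-trans; <-irrefl; <⇒≱; ≤⇒≯; +-monoˡ-<; +-monoʳ-<; +-mono-<-≤;
         ∸-monoʳ-<; m⊓n≤m; m⊓n≤n; m∸n≤m; m≤m+n; m≤n+m; m∸[m∸n]≡n; m+n∸n≡m)
open import Data.Bool using (Bool; true; false; not; _∨_; if_then_else_)
open import Data.Bool.Properties using (T-≡; T-∧)
open import Data.Bool.ListAction using (or)
open import Data.List using (List; map; upTo)
open import Data.List.Properties using (map-cong-local)
open import Data.List.Membership.Propositional using (_∈_; find)
open import Data.List.Membership.Propositional.Properties using (∈-map⁻; ∈-upTo⁻)
open import Data.List.Relation.Unary.All using (tabulate)
open import Data.List.Relation.Unary.Any.Properties using (any⁻)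
open import Data.Product using (_×_; _,_; proj₁; proj₂; Σ-syntax; ∃-syntax)
open import Data.Empty using (⊥-elim)
open import Function.Bundles using (Equivalence)
open import Relation.Nullary using (¬_)
open import Relation.Nullary.Decidable using (toWitness)
open import Relation.Binary.PropositionalEquality using (_≡_; refl; cong; cong₂; trans; sym; subst₂)

open Equivalence using (to; from)

∈-map-suc-upTo⁻ : ∀ {n k} → k ∈ map suc (upTo n) → 1 ≤ k × k ≤ n
∈-map-suc-upTo⁻ k∈ with _ , j∈ , refl ← ∈-map⁻ suc k∈ = s≤s z≤n , ∈-upTo⁻ j∈

anyUpTo-witness : ∀ n f → anyUpTo n f ≡ true → ∃[ k ] (1 ≤ k × k ≤ n × f k ≡ true)
anyUpTo-witness n f e with k , k∈ , fk ← find (any⁻ f _ (from T-≡ e)) =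
  k , proj₁ (∈-map-suc-upTo⁻ k∈) , proj₂ (∈-map-suc-upTo⁻ k∈) , to T-≡ fk

anyUpTo-cong : ∀ n {f g : ℕ → Bool} → (∀ k → 1 ≤ k → k ≤ n → f k ≡ g k) →
               anyUpTo n f ≡ anyUpTo n g
anyUpTo-cong n f≗g = cong or (map-cong-local (tabulate λ {k} k∈ →
  f≗g k (proj₁ (∈-map-suc-upTo⁻ k∈)) (proj₂ (∈-map-suc-upTo⁻ k∈))))

memB-true⁻ : ∀ {x y} L → memB (x , y) L ≡ true → (x , y) ∈ L
memB-true⁻ {x} {y} L e with (a , b) , ab∈L , eq ← find (any⁻ _ L (from T-≡ e))
  with refl ← toWitness {a? = x ≟ a} (proj₁ (to T-∧ eq))
     | refl ← toWitness {a? = y ≟ b} (proj₂ (to T-∧ eq)) = ab∈L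

memB-beyond-bound : ∀ {mx x y} L → (∀ a b → (a , b) ∈ L → a < mx) → mx ≤ x →
                    memB (x , y) L ≡ false
memB-beyond-bound {x = x} {y} L bound mx≤x with memB (x , y) L in e
... | false = refl
... | true  = ⊥-elim (≤⇒≯ mx≤x (bound x y (memB-true⁻ L e)))

horizontal-move-< : ∀ {x k} y → 1 ≤ k → k ≤ x → x ∸ k + y < x + y
horizontal-move-< y 1≤k k≤x = +-monoˡ-< y (∸-monoʳ-< 1≤k k≤x)

vertical-move-< : ∀ x {y k} → 1 ≤ k → k ≤ y → x + (y ∸ k) < x + y
vertical-move-< x 1≤k k≤y = +-monoʳ-< x (∸-monoʳ-< 1≤k k≤y)

diagonal-move-< : ∀ {x y k} → 1 ≤ k → k ≤ x ⊓ y → x ∸ k + (y ∸ k) < x + y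
diagonal-move-< {x} {y} {k} 1≤k k≤x⊓y =
  +-mono-<-≤ (∸-monoʳ-< 1≤k (≤-trans k≤x⊓y (m⊓n≤m x y))) (m∸n≤m y k)

module _ (Ps Ns : List Pos) where

  labelF-fuel-irrelevant : ∀ f g x y → x + y < f → x + y < g →
                           labelF Ps Ns f x y ≡ labelF Ps Ns g x y
  labelF-fuel-irrelevant (suc f) (suc g) x y (s≤s x+y≤f) (s≤s x+y≤g) =
    cong (λ b → if memB (x , y) Ps then true else if memB (x , y) Ns then false else not b)
      (cong₂ _∨_ (anyUpTo-cong x λ k 1≤k k≤x → follower (horizontal-move-< y 1≤k k≤x))
        (cong₂ _∨_ (anyUpTo-cong y λ k 1≤k k≤y → follower (vertical-move-< x 1≤k k≤y))
                   (anyUpTo-cong (x ⊓ y) λ k 1≤k k≤x⊓y → follower (diagonal-move-< 1≤k k≤x⊓y))))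
    where
    follower : ∀ {x′ y′} → x′ + y′ < x + y → labelF Ps Ns f x′ y′ ≡ labelF Ps Ns g x′ y′
    follower {x′} {y′} lt =
      labelF-fuel-irrelevant f g x′ y′ (<-≤-trans lt x+y≤f) (<-≤-trans lt x+y≤g)

  labelF≡isP : ∀ {f x y} → x + y < f → labelF Ps Ns f x y ≡ isP Ps Ns x y
  labelF≡isP {f} {x} {y} x+y<f = labelF-fuel-irrelevant f (suc (x + y)) x y x+y<f ≤-refl

  isP-unfold : ∀ {x y} → memB (x , y) Ps ≡ false → memB (x , y) Ns ≡ false →
               isP Ps Ns x y ≡ not ( anyUpTo x (λ k → isP Ps Ns (x ∸ k) y)
                                   ∨ anyUpTo y (λ k → isP Ps Ns x (y ∸ k))
                                   ∨ anyUpTo (x ⊓ y) (λ k → isP Ps Ns (x ∸ k) (y ∸ k)))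
  isP-unfold {x} {y} ∉Ps ∉Ns rewrite ∉Ps | ∉Ns =
    cong not
      (cong₂ _∨_ (anyUpTo-cong x λ k 1≤k k≤x → labelF≡isP (horizontal-move-< y 1≤k k≤x))
        (cong₂ _∨_ (anyUpTo-cong y λ k 1≤k k≤y → labelF≡isP (vertical-move-< x 1≤k k≤y))
                   (anyUpTo-cong (x ⊓ y) λ k 1≤k k≤x⊓y →
                      labelF≡isP (diagonal-move-< 1≤k k≤x⊓y))))

  data PFollower (x y : ℕ) : Set where
    horizontal : ∀ k → 1 ≤ k → k ≤ x → isP Ps Ns (x ∸ k) y ≡ true → PFollower x y
    vertical   : ∀ k → 1 ≤ k → k ≤ y → isP Ps Ns x (y ∸ k) ≡ true → PFollower x y
    diagonal   : ∀ k → 1 ≤ k → k ≤ x ⊓ y → isP Ps Ns (x ∸ k) (y ∸ k) ≡ true → PFollower x y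

  N-position-has-P-follower : ∀ {x y} → memB (x , y) Ps ≡ false → memB (x , y) Ns ≡ false →
                              isP Ps Ns x y ≡ false → PFollower x y
  N-position-has-P-follower {x} {y} ∉Ps ∉Ns isN
    with anyUpTo x (λ k → isP Ps Ns (x ∸ k) y) in h
       | anyUpTo y (λ k → isP Ps Ns x (y ∸ k)) in v
       | anyUpTo (x ⊓ y) (λ k → isP Ps Ns (x ∸ k) (y ∸ k)) in d
       | isP-unfold {x} {y} ∉Ps ∉Ns  -- abstracted with the searches: reads isP ≡ true in the last case
  ... | true | _ | _ | _
      with k , 1≤k , k≤x , p ← anyUpTo-witness x _ h = horizontal k 1≤k k≤x p
  ... | false | true | _ | _
      with k , 1≤k , k≤y , p ← anyUpTo-witness y _ v = vertical k 1≤k k≤y p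
  ... | false | false | true | _
      with k , 1≤k , k≤x⊓y , p ← anyUpTo-witness (x ⊓ y) _ d = diagonal k 1≤k k≤x⊓y p
  ... | false | false | false | isP≡true with () ← trans (sym isN) isP≡true

  P-position-on-own-diagonal : ∀ {t y} → isP Ps Ns t y ≡ true → Diag Ps Ns t y
  P-position-on-own-diagonal p = 0 , z≤n , z≤n , p

  Row⇒Diag-above : ∀ {t y} → Row Ps Ns t y → Σ[ y′ ∈ ℕ ] (y ≤ y′ × Diag Ps Ns t y′)
  Row⇒Diag-above {t} {y} (x′ , x′≤t , p) =
    y + (t ∸ x′) , m≤m+n y (t ∸ x′) ,
    (t ∸ x′ , m∸n≤m t x′ , m≤n+m (t ∸ x′) y ,
     subst₂ (λ a b → isP Ps Ns a b ≡ true) (sym (m∸[m∸n]≡n x′≤t)) (sym (m+n∸n≡m y (t ∸ x′))) p)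

  Row-below-diagonals : ∀ {t y} → memB (t , y) Ps ≡ false → memB (t , y) Ns ≡ false →
                        (∀ y′ → Diag Ps Ns t y′ → y < y′) → Row Ps Ns t y
  Row-below-diagonals {t} {y} ∉Ps ∉Ns above with isP Ps Ns t y in isP[t,y]
  ... | true = t , ≤-refl , isP[t,y]
  ... | false with N-position-has-P-follower ∉Ps ∉Ns isP[t,y]
  ... | horizontal k _ k≤t p = t ∸ k , m∸n≤m t k , p
  ... | vertical k _ _ p =
        ⊥-elim (<⇒≱ (above (y ∸ k) (P-position-on-own-diagonal p)) (m∸n≤m y k))
  ... | diagonal k _ k≤t⊓y p =
        ⊥-elim (<-irrefl refl
          (above y (k , ≤-trans k≤t⊓y (m⊓n≤m t y) , ≤-trans k≤t⊓y (m⊓n≤n t y) , p)))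

lemma1 : (Ps Ns : List Pos) → Disjoint Ps Ns → (mx : ℕ) → BoundsFirst mx Ps Ns →
         (t : ℕ) → mx ≤ t → (l u : ℕ) → IsMinDiag Ps Ns t l → IsMaxDiag Ps Ns t u →
         (∀ y → y < l → Row Ps Ns t y) × (∀ y → u < y → ¬ Row Ps Ns t y)
lemma1 Ps Ns _ mx (boundPs , boundNs) t mx≤t l u (_ , l-min) (_ , u-max) = below-ℓ , above-u
  where
  below-ℓ : ∀ y → y < l → Row Ps Ns t y
  below-ℓ y y<l = Row-below-diagonals Ps Ns
    (memB-beyond-bound Ps boundPs mx≤t) (memB-beyond-bound Ns boundNs mx≤t)
    (λ y′ d → <-≤-trans y<l (l-min y′ d))

  above-u : ∀ y → u < y → ¬ Row Ps Ns t y
  above-u y u<y row with y′ , y≤y′ , d ← Row⇒Diag-above Ps Ns row =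
    <⇒≱ u<y (≤-trans y≤y′ (u-max y′ d))
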